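{- Let $G$ be a graph with no universal vertices or true twins, let $\{u,\bar u\}$ be a circular pair in $G$, and let $G'$ be a circular completion of $G$. Then $\{u,\bar u\}$ is also a circular pair in $G'$.
   Context: Graphs are finite with a loop at every vertex; $N[u]$ is the closed neighbourhood. Universal vertex: $N[u]=V$; true twins: $N[u]=N[v]$. Edge types: $uv$ is an inclusion edge if $N[u],N[v]$ are comparable under inclusion, otherwise an overlap edge; $\{u,v\}$ is a spanning pair if every $x\notin N[v]$ has $N[x]\subseteq N[u]$ and every $y\notin N[u]$ has $N[y]\subseteq N[v]$; an overlap edge is 2-overlap if its endpoints form a spanning pair, 1-overlap otherwise. $\{u,v\}$ is a circular pair if it is a spanning pair and $uv\notin E$. A graph is circularly-paired if every vertex belongs to some circular pair. A circular completion of $G$ is a circularly-paired graph $H$ with the minimum number of vertices such that $H$ contains $G$ as an induced subgraph and every edge of $G$ has the same type in $G$ and in $H$. -}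

module Defs where

open import Data.Nat using (ℕ; _≤_)
open import Data.Fin using (Fin)
open import Data.Bool using (Bool; true; false)
open import Data.Product using (Σ; ∃; _×_)
open import Data.Sum using (_⊎_)
open import Relation.Nullary using (¬_)
open import Relation.Binary.PropositionalEquality using (_≡_; _≢_)
open import Function.Bundles using (_⇔_)
open import Function.Definitions using (Injective)

-- A finite graph on vertex set Fin n, with a loop at every vertex.
-- adj u v ≡ true means uv ∈ E (so adj u x ≡ true means x ∈ N[u]).
record Graph (n : ℕ) : Set where
  field
    adj     : Fin n → Fin n → Bool
    adj-sym : ∀ u v → adj u v ≡ adj v u
    adj-refl : ∀ u → adj u u ≡ true
open Graph public

module _ {n : ℕ} (G : Graph n) where

  NSub : Fin n → Fin n → Set
  NSub u v = ∀ x → adj G u x ≡ true → adj G v x ≡ true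

  Universal : Fin n → Set
  Universal u = ∀ x → adj G u x ≡ true

  TrueTwins : Fin n → Fin n → Set
  TrueTwins u v = ∀ x → adj G u x ≡ adj G v x

  NoUniversal : Set
  NoUniversal = ∀ u → ¬ Universal u

  NoTrueTwins : Set
  NoTrueTwins = ∀ u v → u ≢ v → ¬ TrueTwins u v

  InclusionEdge : Fin n → Fin n → Set
  InclusionEdge u v = adj G u v ≡ true × (NSub u v ⊎ NSub v u)

  OverlapEdge : Fin n → Fin n → Set
  OverlapEdge u v = adj G u v ≡ true × ¬ (NSub u v ⊎ NSub v u)

  SpanningPair : Fin n → Fin n → Set
  SpanningPair u v =
    (∀ x → adj G v x ≡ false → NSub x u) × (∀ y → adj G u y ≡ false → NSub y v)

  TwoOverlap : Fin n → Fin n → Set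
  TwoOverlap u v = OverlapEdge u v × SpanningPair u v

  OneOverlap : Fin n → Fin n → Set
  OneOverlap u v = OverlapEdge u v × ¬ SpanningPair u v

  CircularPair : Fin n → Fin n → Set
  CircularPair u v = SpanningPair u v × adj G u v ≡ false

  CircularlyPaired : Set
  CircularlyPaired = ∀ u → ∃ λ v → CircularPair u v

record TypePreservingEmbedding {n m : ℕ} (G : Graph n) (H : Graph m)
                               (f : Fin n → Fin m) : Set where
  field
    injective : Injective _≡_ _≡_ f
    induced   : ∀ u v → adj H (f u) (f v) ≡ adj G u v
    incl-pres : ∀ u v → adj G u v ≡ true →
                  InclusionEdge G u v ⇔ InclusionEdge H (f u) (f v)
    one-pres  : ∀ u v → adj G u v ≡ true →
                  OneOverlap G u v ⇔ OneOverlap H (f u) (f v)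
    two-pres  : ∀ u v → adj G u v ≡ true →
                  TwoOverlap G u v ⇔ TwoOverlap H (f u) (f v)

record CircularCompletion {n m : ℕ} (G : Graph n) (H : Graph m)
                          (f : Fin n → Fin m) : Set where
  field
    paired    : CircularlyPaired H
    embedding : TypePreservingEmbedding G H f
    minimal   : ∀ (k : ℕ) (H' : Graph k) (g : Fin n → Fin k) →
                  CircularlyPaired H' → TypePreservingEmbedding G H' g → m ≤ k

-- Let H be a circular completion of G. Besides the vertices of G, only the chosen circular
-- partners in H of the vertices c ∉ {u, ū} are needed: the subgraph of H induced by this
-- core is still circularly-paired and type-preserving, so by minimality the core is all of
-- H. A core vertex y outside N[ū] has N[y] ⊆ N[u] in H: for a vertex of G, because cu is
-- an inclusion edge of G and hence of H; for the partner y of c, because N[ū] ⊆ N[c] in H,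
-- which (G having no universal vertices or true twins) makes cu a 2-overlap edge of G and
-- hence of H, and y ∉ N[c].
module Submission where

open import Defs
open import Level using (0ℓ)
open import Data.Nat using (ℕ; _<_)
open import Data.Nat.Properties using (<⇒≱)
open import Data.Fin using (Fin; _≟_)
open import Data.Fin.Properties using (any?)
open import Data.Bool using (true; false)
open import Data.Unit using (⊤)
open import Data.Empty using (⊥-elim)
open import Data.Product using (∃; _×_; _,_; proj₁; proj₂; swap)
open import Data.Sum using (_⊎_; inj₁; inj₂)
open import Data.List using (List; filter; length; lookup; allFin)
open import Data.List.Properties using (filter-notAll; length-tabulate)
open import Data.List.Relation.Unary.Any as Any using ()
open import Data.List.Relation.Unary.Any.Properties using (lookup-index)
open import Data.List.Membership.Propositional.Properties using (∈-filter⁺; ∈-filter⁻; ∈-lookup; ∈-allFin)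
open import Relation.Nullary using (¬_; yes; no; contradiction)
open import Relation.Nullary.Decidable using (_×-dec_; _⊎-dec_; ¬?)
open import Relation.Unary using (Pred; Decidable)
open import Relation.Binary.PropositionalEquality
open import Function using (id)
open import Function.Bundles using (_⇔_; mk⇔; Equivalence)

Induced : ∀ {a b} → Graph a → Graph b → (Fin a → Fin b) → Set
Induced A B h = ∀ i j → adj B (h i) (h j) ≡ adj A i j

induce : ∀ {k m} → Graph m → (Fin k → Fin m) → Graph k
induce H e = record
  { adj      = λ i j → adj H (e i) (e j)
  ; adj-sym  = λ i j → adj-sym H (e i) (e j)
  ; adj-refl = λ i → adj-refl H (e i)
  }

module _ {m : ℕ} (H : Graph m) (S : Pred (Fin m) 0ℓ) where

  record SpanningPairOn (u v : Fin m) : Set where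
    constructor _,_
    field
      far-from-v : ∀ x → S x → adj H v x ≡ false → NSub H x u
      far-from-u : ∀ y → S y → adj H u y ≡ false → NSub H y v

  CircularPairOn : Fin m → Fin m → Set
  CircularPairOn u v = SpanningPairOn u v × adj H u v ≡ false

module _ {m : ℕ} {H : Graph m} {S : Pred (Fin m) 0ℓ} where

  circular⇒circularOn : ∀ {u v} → CircularPair H u v → CircularPairOn H S u v
  circular⇒circularOn ((s₁ , s₂) , uv) = ((λ x _ → s₁ x) , (λ y _ → s₂ y)) , uv

  circularOn-sym : ∀ {u v} → CircularPairOn H S u v → CircularPairOn H S v u
  circularOn-sym {u} {v} ((s₁ , s₂) , uv) = (s₂ , s₁) , trans (adj-sym H v u) uv

  spanningOn-total : (∀ y → S y) → ∀ {u v} → SpanningPairOn H S u v → SpanningPair H u v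
  spanningOn-total total (s₁ , s₂) = (λ x → s₁ x (total x)) , (λ y → s₂ y (total y))

module InducedReflects {a b} (A : Graph a) (B : Graph b) (h : Fin a → Fin b)
                       (induced : Induced A B h) where

  nsub⁻ : ∀ {i j} → NSub B (h i) (h j) → NSub A i j
  nsub⁻ {i} {j} s y iy = trans (sym (induced j y)) (s (h y) (trans (induced i y) iy))

  inclusion⁻ : ∀ {i j} → InclusionEdge B (h i) (h j) → InclusionEdge A i j
  inclusion⁻ {i} {j} (ij , inj₁ s) = trans (sym (induced i j)) ij , inj₁ (nsub⁻ s)
  inclusion⁻ {i} {j} (ij , inj₂ s) = trans (sym (induced i j)) ij , inj₂ (nsub⁻ s)

  spanningOn⁻ : ∀ {S : Pred (Fin b) 0ℓ} {i j} → (∀ x → S (h x)) →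
                SpanningPairOn B S (h i) (h j) → SpanningPair A i j
  spanningOn⁻ {i = i} {j} inS (s₁ , s₂) =
    (λ x jx → nsub⁻ (s₁ (h x) (inS x) (trans (induced j x) jx))) ,
    (λ y iy → nsub⁻ (s₂ (h y) (inS y) (trans (induced i y) iy)))

  spanning⁻ : ∀ {i j} → SpanningPair B (h i) (h j) → SpanningPair A i j
  spanning⁻ (s₁ , s₂) = spanningOn⁻ {S = λ _ → ⊤} _ ((λ x _ → s₁ x) , (λ y _ → s₂ y))

  circularOn⁻ : ∀ {S : Pred (Fin b) 0ℓ} {i j} → (∀ x → S (h x)) →
                CircularPairOn B S (h i) (h j) → CircularPair A i j
  circularOn⁻ {i = i} {j} inS (sp , ij) = spanningOn⁻ inS sp , trans (sym (induced i j)) ij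

module Enumeration {m : ℕ} {P : Pred (Fin m) 0ℓ} (P? : Decidable P) where

  elements : List (Fin m)
  elements = filter P? (allFin m)

  size : ℕ
  size = length elements

  at : Fin size → Fin m
  at = lookup elements

  at-∈ : ∀ i → P (at i)
  at-∈ i = proj₂ (∈-filter⁻ P? {xs = allFin m} (∈-lookup i))

  indexOf : ∀ y → P y → Fin size
  indexOf y py = Any.index (∈-filter⁺ P? (∈-allFin y) py)

  at-indexOf : ∀ y (py : P y) → at (indexOf y py) ≡ y
  at-indexOf y py = sym (lookup-index (∈-filter⁺ P? (∈-allFin y) py))

  size< : ∀ x → ¬ P x → size < m
  size< x ¬px = subst (size <_) (length-tabulate id)
    (filter-notAll P? (allFin m) (Any.map (λ { refl → ¬px }) (∈-allFin x)))

module _ {n : ℕ} (G : Graph n) where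

  NSub⇒adj : ∀ {c d} → NSub G c d → adj G c d ≡ true
  NSub⇒adj {c} {d} s = trans (adj-sym G c d) (s c (adj-refl G c))

  circularPair-sym : ∀ {u v} → CircularPair G u v → CircularPair G v u
  circularPair-sym {u} {v} (sp , uv) = swap sp , trans (adj-sym G v u) uv

  NSub-antisym : NoTrueTwins G → ∀ {c d} → NSub G c d → NSub G d c → c ≡ d
  NSub-antisym noT {c} {d} s t with c ≟ d
  ... | yes c≡d = c≡d
  ... | no  c≢d = ⊥-elim (noT c d c≢d twins)
    where
      twins : TrueTwins G c d
      twins x with adj G c x in cx | adj G d x in dx
      ... | true  | true  = refl
      ... | false | false = refl
      ... | true  | false = contradiction (trans (sym (s x cx)) dx) λ ()
      ... | false | true  = contradiction (trans (sym (t x dx)) cx) λ ()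

  twoOverlap-of-⊇ : NoUniversal G → NoTrueTwins G → ∀ {u ū c} → CircularPair G u ū →
                    c ≢ ū → NSub G ū c → TwoOverlap G c u
  twoOverlap-of-⊇ noU noT {u} {ū} {c} ((ū-far , u-far) , uū) c≢ū ū⊆c =
    (cu , λ { (inj₁ c⊆u) → contradiction (trans (sym (c⊆u ū cū)) uū) λ ()
            ; (inj₂ u⊆c) → noU c (universal u⊆c) }) ,
    (λ x ux z xz → ū⊆c z (u-far x ux z xz)) , c-far
    where
      cū : adj G c ū ≡ true
      cū = ū⊆c ū (adj-refl G ū)

      cu : adj G c u ≡ true
      cu with adj G c u in cu
      ... | true  = refl
      ... | false = ⊥-elim (c≢ū (NSub-antisym noT (u-far c (trans (adj-sym G u c) cu)) ū⊆c))

      universal : NSub G u c → Universal G c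
      universal u⊆c t with adj G ū t in ūt
      ... | true  = ū⊆c t ūt
      ... | false = u⊆c t (ū-far t ūt t (adj-refl G t))

      c-far : ∀ y → adj G c y ≡ false → NSub G y u
      c-far y cy with adj G ū y in ūy
      ... | true  = contradiction (trans (sym (ū⊆c y ūy)) cy) λ ()
      ... | false = ū-far y ūy

module _ {n m : ℕ} {G : Graph n} {H : Graph m} {f : Fin n → Fin m}
         (emb : TypePreservingEmbedding G H f) where

  open TypePreservingEmbedding emb
  open InducedReflects G H f induced

  image-dominated : NoTrueTwins G → ∀ {u ū c} → CircularPair G u ū →
                    adj G ū c ≡ false → NSub H (f c) (f u)
  image-dominated noT {u} {ū} {c} ((ū-far , _) , _) ūc with c ≟ u
  ... | yes refl = λ _ cx → cx
  ... | no  c≢u  with proj₂ (Equivalence.to (incl-pres c u cu) (cu , inj₁ c⊆u))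
    where
      c⊆u : NSub G c u
      c⊆u = ū-far c ūc
      cu : adj G c u ≡ true
      cu = NSub⇒adj G c⊆u
  ... | inj₁ fc⊆fu = fc⊆fu
  ... | inj₂ fu⊆fc = ⊥-elim (c≢u (NSub-antisym G noT (ū-far c ūc) (nsub⁻ fu⊆fc)))

  partner-dominated : NoUniversal G → NoTrueTwins G → ∀ {u ū c x} → CircularPair G u ū →
                      c ≢ ū → CircularPair H (f c) x → adj H (f ū) x ≡ false →
                      NSub H x (f u)
  partner-dominated noU noT {u} {ū} {c} {x} cp c≢ū ((x-far , _) , cx) ūx =
    proj₂ (proj₂ (Equivalence.to (two-pres c u (proj₁ (proj₁ cu-two))) cu-two)) x cx
    where
      cu-two : TwoOverlap G c u
      cu-two = twoOverlap-of-⊇ G noU noT cp c≢ū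
                 (nsub⁻ (x-far (f ū) (trans (adj-sym H x (f ū)) ūx)))

restrict-embedding : ∀ {n m k} {G : Graph n} {H : Graph m} {f : Fin n → Fin m} →
                     TypePreservingEmbedding G H f →
                     (e : Fin k → Fin m) (g : Fin n → Fin k) → (∀ c → e (g c) ≡ f c) →
                     TypePreservingEmbedding G (induce H e) g
restrict-embedding {m = m} {G = G} {H} {f} emb e g eg≡f = record
  { injective = λ {c} {d} gc≡gd → injective (trans (sym (eg≡f c)) (trans (cong e gc≡gd) (eg≡f d)))
  ; induced   = g-induced
  ; incl-pres = inclusion⇔
  ; one-pres  = λ c d cd → mk⇔
      (λ { (ov , ¬sp) → overlap⁺ ov , λ sp → ¬sp (G.spanning⁻ sp) })
      (λ { (ov , ¬sp) → overlap⁻ cd ov , λ sp → ¬sp (spanning⁺ cd (overlap⁻ cd ov , sp)) })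
  ; two-pres  = λ c d cd → mk⇔
      (λ { (ov , sp) → overlap⁺ ov , spanning⁺ cd (ov , sp) })
      (λ { (ov , sp) → overlap⁻ cd ov , G.spanning⁻ sp })
  }
  where
    open TypePreservingEmbedding emb
    H' = induce H e
    module E = InducedReflects H' H e (λ _ _ → refl)

    g-induced : Induced G H' g
    g-induced c d = trans (cong₂ (adj H) (eg≡f c) (eg≡f d)) (induced c d)
    module G = InducedReflects G H' g g-induced

    lift : (X : Fin m → Fin m → Set) → ∀ {c d} → X (f c) (f d) → X (e (g c)) (e (g d))
    lift X {c} {d} = subst₂ X (sym (eg≡f c)) (sym (eg≡f d))

    inclusion⇔ : ∀ c d → adj G c d ≡ true → InclusionEdge G c d ⇔ InclusionEdge H' (g c) (g d)
    inclusion⇔ c d cd =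
      mk⇔ (λ incl → E.inclusion⁻ (lift (InclusionEdge H) (Equivalence.to (incl-pres c d cd) incl)))
          G.inclusion⁻

    overlap⁺ : ∀ {c d} → OverlapEdge G c d → OverlapEdge H' (g c) (g d)
    overlap⁺ {c} {d} (cd , ¬incl) = trans (g-induced c d) cd ,
      λ { (inj₁ s) → ¬incl (inj₁ (G.nsub⁻ s)) ; (inj₂ s) → ¬incl (inj₂ (G.nsub⁻ s)) }

    overlap⁻ : ∀ {c d} → adj G c d ≡ true → OverlapEdge H' (g c) (g d) → OverlapEdge G c d
    overlap⁻ {c} {d} cd (_ , ¬incl) =
      cd , λ incl → ¬incl (proj₂ (Equivalence.to (inclusion⇔ c d cd) (cd , incl)))

    spanning⁺ : ∀ {c d} → adj G c d ≡ true → TwoOverlap G c d → SpanningPair H' (g c) (g d)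
    spanning⁺ {c} {d} cd two =
      E.spanning⁻ (lift (SpanningPair H) (proj₂ (Equivalence.to (two-pres c d cd) two)))

module _ {n m : ℕ} {G : Graph n} {H : Graph m} {f : Fin n → Fin m}
         (cc : CircularCompletion G H f) where

  open CircularCompletion cc
  open TypePreservingEmbedding embedding using (induced)

  -- Otherwise the set would induce a strictly smaller circular completion candidate.
  completion-closed-total : (S : Pred (Fin m) 0ℓ) → Decidable S → (∀ c → S (f c)) →
                            (∀ y → S y → ∃ λ z → S z × CircularPairOn H S y z) →
                            ∀ y → S y
  completion-closed-total S S? f∈S closed y with S? y
  ... | yes y∈S = y∈S
  ... | no  y∉S = contradiction (minimal size (induce H at) g paired′ emb′) (<⇒≱ (size< y y∉S))
    where
      open Enumeration S?
      open InducedReflects (induce H at) H at (λ _ _ → refl)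

      g : Fin _ → Fin size
      g c = indexOf (f c) (f∈S c)

      emb′ : TypePreservingEmbedding G (induce H at) g
      emb′ = restrict-embedding embedding at g (λ c → at-indexOf (f c) (f∈S c))

      paired′ : CircularlyPaired (induce H at)
      paired′ i with closed (at i) (at-∈ i)
      ... | z , z∈S , cp = indexOf z z∈S ,
        circularOn⁻ at-∈ (subst (CircularPairOn H S (at i)) (sym (at-indexOf z z∈S)) cp)

  partner : Fin m → Fin m
  partner y = proj₁ (paired y)

  -- Partners of u and ū are deliberately left out: they need not be dominated.
  Core : Fin n → Fin n → Pred (Fin m) 0ℓ
  Core u ū y = (∃ λ c → f c ≡ y) ⊎ (∃ λ c → (c ≢ u × c ≢ ū) × partner (f c) ≡ y)

  core? : ∀ u ū → Decidable (Core u ū)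
  core? u ū y = any? (λ c → f c ≟ y) ⊎-dec
                any? (λ c → (¬? (c ≟ u) ×-dec ¬? (c ≟ ū)) ×-dec (partner (f c) ≟ y))

  core-swap : ∀ {u ū y} → Core u ū y → Core ū u y
  core-swap (inj₁ image) = inj₁ image
  core-swap (inj₂ (c , ≢s , eq)) = inj₂ (c , swap ≢s , eq)

  core-dominated : NoUniversal G → NoTrueTwins G → ∀ {u ū} → CircularPair G u ū →
                   ∀ y → Core u ū y → adj H (f ū) y ≡ false → NSub H y (f u)
  core-dominated noU noT {ū = ū} cp y (inj₁ (c , refl)) ūy =
    image-dominated embedding noT cp (trans (sym (induced ū c)) ūy)
  core-dominated noU noT cp y (inj₂ (c , (_ , c≢ū) , refl)) ūy =
    partner-dominated embedding noU noT cp c≢ū (proj₂ (paired (f c))) ūy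

  core-circular : NoUniversal G → NoTrueTwins G → ∀ {u ū} → CircularPair G u ū →
                  CircularPairOn H (Core u ū) (f u) (f ū)
  core-circular noU noT {u} {ū} cp =
    ( (λ y y∈core → core-dominated noU noT cp y y∈core)
    , (λ y y∈core → core-dominated noU noT (circularPair-sym G cp) y (core-swap y∈core)) )
    , trans (induced u ū) (proj₂ cp)

  core-closed : NoUniversal G → NoTrueTwins G → ∀ {u ū} → CircularPair G u ū →
                ∀ y → Core u ū y → ∃ λ z → Core u ū z × CircularPairOn H (Core u ū) y z
  core-closed noU noT {u} {ū} cp y (inj₁ (c , refl)) with c ≟ u | c ≟ ū
  ... | yes refl | _        = f ū , inj₁ (ū , refl) , core-circular noU noT cp
  ... | no _     | yes refl = f u , inj₁ (u , refl) , circularOn-sym (core-circular noU noT cp)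
  ... | no c≢u   | no c≢ū   = partner (f c) , inj₂ (c , (c≢u , c≢ū) , refl) ,
                              circular⇒circularOn (proj₂ (paired (f c)))
  core-closed noU noT cp y (inj₂ (c , _ , refl)) =
    f c , inj₁ (c , refl) , circularOn-sym (circular⇒circularOn (proj₂ (paired (f c))))

corollary14 : ∀ {n m : ℕ} (G : Graph n) (G' : Graph m) (f : Fin n → Fin m)
    (u ū : Fin n) → NoUniversal G → NoTrueTwins G → CircularPair G u ū →
    CircularCompletion G G' f → CircularPair G' (f u) (f ū)
corollary14 G G' f u ū noU noT cp cc =
  spanningOn-total core-total (proj₁ uū-circular) , proj₂ uū-circular
  where
    uū-circular : CircularPairOn G' (Core cc u ū) (f u) (f ū)
    uū-circular = core-circular cc noU noT cp

    core-total : ∀ y → Core cc u ū y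
    core-total = completion-closed-total cc (Core cc u ū) (core? cc u ū)
                   (λ c → inj₁ (c , refl)) (core-closed cc noU noT cp)
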